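{- Let $p,q,k,m$ be natural numbers with $k\le p\le q\le m$. If $${m\brack p}\cdot 2^{ -{p\brack k}}+{m\brack q}\cdot 2^{ -{q\brack k}}<1,$$ then $\mathcal{R}_1(p,q,k)>m$.
   Context: $T_n=n(n+1)/2$, $T_0=0$. A finite set $X\subseteq\mathbb{N}$ with $|X|=T_n$, enumerated $x_1<\dots<x_{T_n}$, has $i$-th level $\{x_{T_{i-1}+1},\dots,x_{T_i}\}$ for $1\le i\le n$; $\triangle_n$ is the set of all such sets. For such sets, $X\le Y$ means $X\subseteq Y$ and every level of $X$ is contained in a single level of $Y$, distinct levels of $X$ being contained in distinct levels of $Y$; $\triangle_k(B)=\{Z\in\triangle_k:Z\le B\}$. For natural numbers $k\le p,q$, a completed game of Mines$_m(p,q,k)$ is a partition $\triangle_k(B)=X\sqcup Y$ with $B\in\triangle_m$; it is a win for player one if there is $Z\in\triangle_p(B)$ with $\triangle_k(Z)\subseteq X$, a win for player two if there is $Z\in\triangle_q(B)$ with $\triangle_k(Z)\subseteq Y$, and a draw otherwise. $\mathcal{R}_1(p,q,k)$ is the least $m\ge\max(p,q)$ such that no completed game of Mines$_m(p,q,k)$ is a draw. The numbers ${n\brack k}$ are defined by ${n\brack0}={n\brack n}=1$ and ${n\brack k}={n-1\brack k}+\binom nk{n-1\brack k-1}$ for $0<k<n$. -}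

module Defs where

open import Data.Nat using (ℕ; zero; suc; _+_; _*_; _^_; _<_; _≤_; _⊔_)
open import Data.Nat.Combinatorics using (_C_)
open import Data.Bool using (Bool; true; false)
open import Data.Fin using (Fin; toℕ)
open import Data.List using (List; length; take; drop)
open import Data.List.Relation.Unary.Linked using (Linked)
open import Data.List.Relation.Binary.Subset.Propositional using (_⊆_)
open import Data.Product using (Σ; _×_; ∃)
open import Relation.Binary.PropositionalEquality using (_≡_)
open import Relation.Nullary using (¬_)
open import Function.Definitions using (Injective)

T : ℕ → ℕ
T zero    = 0
T (suc n) = T n + suc n

-- Finite subsets of ℕ are represented by strictly increasing lists
-- (the enumeration x₁ < x₂ < … ).
-- X ∈ △ₙ : X is a strictly increasing list of length T n.
Tri : ℕ → List ℕ → Set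
Tri n X = Linked _<_ X × length X ≡ T n

-- The (j+1)-th level of X (j = 0,1,…): entries at 0-based positions
-- T j, …, T (j+1) − 1, i.e. {x_{T_j + 1}, …, x_{T_{j+1}}}.
level : List ℕ → ℕ → List ℕ
level X j = take (suc j) (drop (T j) X)

Leq : ℕ → ℕ → List ℕ → List ℕ → Set
Leq k m X Y =
  X ⊆ Y ×
  Σ (Fin k → Fin m) (λ f →
     Injective _≡_ _≡_ f × (∀ (j : Fin k) → level X (toℕ j) ⊆ level Y (toℕ (f j))))

-- A completed game of Mines_m(p,q,k): B ∈ △ₘ together with a partition
-- △ₖ(B) = X ⊔ Y, given by a colouring c (c W ≡ true ↔ W ∈ X,
-- c W ≡ false ↔ W ∈ Y; values outside △ₖ(B) are irrelevant).
WinOne : (p k m : ℕ) → List ℕ → (List ℕ → Bool) → Set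
WinOne p k m B c =
  ∃ λ Z → Tri p Z × Leq p m Z B ×
    (∀ W → Tri k W → Leq k p W Z → c W ≡ true)

WinTwo : (q k m : ℕ) → List ℕ → (List ℕ → Bool) → Set
WinTwo q k m B c =
  ∃ λ Z → Tri q Z × Leq q m Z B ×
    (∀ W → Tri k W → Leq k q W Z → c W ≡ false)

HasDraw : (p q k m : ℕ) → Set
HasDraw p q k m =
  ∃ λ B → Tri m B × Σ (List ℕ → Bool) (λ c →
    ¬ WinOne p k m B c × ¬ WinTwo q k m B c)

-- 𝓡₁(p,q,k) > m : every m' ≥ max(p,q) for which no completed game of
-- Mines_{m'}(p,q,k) is a draw satisfies m' > m (so the least such m'
-- is > m).
R1Greater : (p q k m : ℕ) → Set
R1Greater p q k m = ∀ m' → p ⊔ q ≤ m' → ¬ HasDraw p q k m' → m < m'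

-- Here extended by 0 for k > n; with this convention the recursion for
-- k = n yields 0 + 1·[n-1 n-1] = 1, so the values for k ≤ n agree.
brk : ℕ → ℕ → ℕ
brk n       zero    = 1
brk zero    (suc k) = 0
brk (suc n) (suc k) = brk n (suc k) + (suc n C suc k) * brk n k

-- It suffices to find, for every m′ ≤ m, a draw of Mines_{m′}(p,q,k); take B = {0, …, T m′ − 1}.
-- Under a uniformly random colouring of △ₖ(B) a fixed Z ∈ △_p(B) is a win for player one with
-- probability 2^−[p k], and |△_p(B)| = [m′ p] ≤ [m p]; likewise for player two with q.  So the
-- hypothesis says that the expected number of wins is below 1, and the method of conditional
-- expectations (colouring one element at a time so that this expectation stays below 1) yields a
-- colouring without any win.  The count |△ₖ(Z)| = [n k] for Z ∈ △ₙ comes from splitting △ₖ(Z)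
-- according to whether the top level of Z is used; if it is, the top level of the subtriangle is
-- sent to a (k+1)-subset of it.
module Submission where

open import Data.Bool using (Bool; true; false)
import Data.Bool.Properties as Bool
open import Data.Empty using (⊥; ⊥-elim)
open import Data.Fin as F using (Fin; toℕ; fromℕ; inject₁; lower₁)
import Data.Fin.Properties as FP
open import Data.List using (List; []; _∷_; _++_; length; take; drop; map; concat; cartesianProductWith; deduplicate; upTo; [_])
import Data.List.Properties as LP
open import Data.List.Membership.Propositional using (_∈_; _∉_)
open import Data.List.Membership.Propositional.Properties
open import Data.List.Relation.Binary.Subset.Propositional using (_⊆_)
open import Data.List.Relation.Unary.All as All using (All; []; _∷_)
import Data.List.Relation.Unary.All.Properties as AllP
open import Data.List.Relation.Unary.AllPairs as AP using (AllPairs; []; _∷_)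
import Data.List.Relation.Unary.AllPairs.Properties as APP
open import Data.List.Relation.Unary.Any using (here; there)
open import Data.List.Relation.Unary.Linked using (Linked)
import Data.List.Relation.Unary.Linked.Properties as LinkedP
open import Data.List.Relation.Unary.Unique.Propositional using (Unique)
import Data.List.Relation.Unary.Unique.Propositional.Properties as UP
open import Data.List.Relation.Unary.Unique.DecPropositional.Properties using (deduplicate-!)
open import Data.Nat using (ℕ; zero; suc; _+_; _*_; _^_; _<_; _≤_; _≤′_; ≤′-refl; ≤′-step; z≤n; s≤s)
open import Data.Nat.Combinatorics using (_C_; nCk+nC[k+1]≡[n+1]C[k+1])
open import Data.Nat.ListAction using (sum)
open import Data.Nat.ListAction.Properties using (sum-++)
open import Data.Nat.Properties
open import Data.Nat.Solver using (module +-*-Solver)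
open import Data.Product using (Σ; _×_; _,_; proj₁; proj₂; ∃)
open import Data.Sum using (_⊎_; inj₁; inj₂)
open import Function using (_∘_; id)
open import Function.Definitions using (Injective)
open import Relation.Binary.Definitions using (DecidableEquality)
open import Relation.Binary.PropositionalEquality hiding ([_])
open import Relation.Nullary using (¬_; yes; no)
open import Defs
open +-*-Solver

private
  variable
    A : Set

take-⊆ : ∀ n (X : List A) → take n X ⊆ X
take-⊆ zero    X       ()
take-⊆ (suc n) []      ()
take-⊆ (suc n) (y ∷ X) (here p)  = here p
take-⊆ (suc n) (y ∷ X) (there p) = there (take-⊆ n X p)

drop-⊆ : ∀ n (X : List A) → drop n X ⊆ X
drop-⊆ zero    X       p = p
drop-⊆ (suc n) []      ()
drop-⊆ (suc n) (y ∷ X) p = there (drop-⊆ n X p)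

take-mono-⊆ : ∀ {a b} → a ≤ b → (X : List A) → take a X ⊆ take b X
take-mono-⊆ {a = zero}                 _         X       ()
take-mono-⊆ {a = suc a}                (s≤s a≤b) []      ()
take-mono-⊆ {a = suc a} {b = suc b} (s≤s a≤b) (y ∷ X) (here p)  = here p
take-mono-⊆ {a = suc a} {b = suc b} (s≤s a≤b) (y ∷ X) (there p) = there (take-mono-⊆ a≤b X p)

take-drop-⊆ : ∀ t s (X : List A) → take s (drop t X) ⊆ take (t + s) X
take-drop-⊆ zero    s       X       p = p
take-drop-⊆ (suc t) zero    []      ()
take-drop-⊆ (suc t) (suc s) []      ()
take-drop-⊆ (suc t) s       (y ∷ X) p = there (take-drop-⊆ t s X p)

take-++ : ∀ n (X Y : List A) → n ≤ length X → take n (X ++ Y) ≡ take n X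
take-++ zero    X       Y _         = refl
take-++ (suc n) (x ∷ X) Y (s≤s n≤) = cong (x ∷_) (take-++ n X Y n≤)

drop-++ : ∀ n (X Y : List A) → n ≤ length X → drop n (X ++ Y) ≡ drop n X ++ Y
drop-++ zero    X       Y _         = refl
drop-++ (suc n) (x ∷ X) Y (s≤s n≤) = drop-++ n X Y n≤

drop-length-++ : ∀ (X Y : List A) → drop (length X) (X ++ Y) ≡ Y
drop-length-++ []      Y = refl
drop-length-++ (x ∷ X) Y = drop-length-++ X Y

≤-length-drop : ∀ a b (X : List A) → a + b ≤ length X → b ≤ length (drop a X)
≤-length-drop zero    b X       h         = h
≤-length-drop (suc a) b (x ∷ X) (s≤s h) = ≤-length-drop a b X h

length-take-+ : ∀ a b (X : List A) → length X ≡ a + b → length (take a X) ≡ a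
length-take-+ zero    b X       _ = refl
length-take-+ (suc a) b (x ∷ X) h = cong suc (length-take-+ a b X (suc-injective h))

length-drop-+ : ∀ a b (X : List A) → length X ≡ a + b → length (drop a X) ≡ b
length-drop-+ zero    b X       h = h
length-drop-+ (suc a) b (x ∷ X) h = length-drop-+ a b X (suc-injective h)

++-cancel-length : ∀ (W X Y Z : List A) → length W ≡ length X → W ++ Y ≡ X ++ Z → W ≡ X × Y ≡ Z
++-cancel-length []      []      Y Z _ e = refl , e
++-cancel-length (a ∷ W) (b ∷ X) Y Z l e
  with ++-cancel-length W X Y Z (suc-injective l) (LP.∷-injectiveʳ e)
... | W≡X , Y≡Z = cong₂ _∷_ (LP.∷-injectiveˡ e) W≡X , Y≡Z

length-cartesianProductWith : ∀ {B C : Set} (f : A → B → C) xs ys →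
  length (cartesianProductWith f xs ys) ≡ length xs * length ys
length-cartesianProductWith f []       ys = refl
length-cartesianProductWith f (x ∷ xs) ys =
  trans (LP.length-++ (map (f x) ys)) (cong₂ _+_ (LP.length-map (f x) ys) (length-cartesianProductWith f xs ys))

Unique-⊆⇒length≤ : ∀ (E S : List A) → Unique E → E ⊆ S → length E ≤ length S
Unique-⊆⇒length≤ []      S _            _   = z≤n
Unique-⊆⇒length≤ (e ∷ E) S (e∉E ∷ uE) E⊆S with ∈-∃++ (E⊆S (here refl))
... | S₁ , S₂ , refl =
  subst (suc (length E) ≤_) (sym (LP.length-++-sucʳ S₁ e S₂))
        (s≤s (Unique-⊆⇒length≤ E (S₁ ++ S₂) uE E⊆S₁S₂))
  where
  E⊆S₁S₂ : E ⊆ S₁ ++ S₂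
  E⊆S₁S₂ {y} y∈E with ∈-++⁻ S₁ (E⊆S (there y∈E))
  ... | inj₁ y∈S₁         = ∈-++⁺ˡ y∈S₁
  ... | inj₂ (here refl)  = ⊥-elim (All.lookup e∉E y∈E refl)
  ... | inj₂ (there y∈S₂) = ∈-++⁺ʳ S₁ y∈S₂

cartesianProductWith-++-unique : ∀ l (xs ys : List (List A)) → All (λ w → length w ≡ l) xs →
  Unique xs → Unique ys → Unique (cartesianProductWith _++_ xs ys)
cartesianProductWith-++-unique l []       ys _           _            _   = []
cartesianProductWith-++-unique l (x ∷ xs) ys (lx ∷ lxs) (x∉xs ∷ uxs) uys =
  UP.++⁺ (UP.map⁺ (LP.++-cancelˡ x _ _) uys) (cartesianProductWith-++-unique l xs ys lxs uxs uys) disjoint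
  where
  disjoint : ∀ {v} → v ∈ map (x ++_) ys × v ∈ cartesianProductWith _++_ xs ys → ⊥
  disjoint (p , q) with ∈-map⁻ (x ++_) p | ∈-cartesianProductWith⁻ _++_ xs ys q
  ... | y , _ , refl | w , z , w∈xs , _ , x++y≡w++z =
    All.lookup x∉xs w∈xs (proj₁ (++-cancel-length x w y z (trans lx (sym (All.lookup lxs w∈xs))) x++y≡w++z))

Sorted : List ℕ → Set
Sorted = AllPairs _<_

linked⇒sorted : ∀ {X} → Linked _<_ X → Sorted X
linked⇒sorted = LinkedP.Linked⇒AllPairs <-trans

sorted⇒linked : ∀ {X} → Sorted X → Linked _<_ X
sorted⇒linked = LinkedP.AllPairs⇒Linked

sorted⇒unique : ∀ {X} → Sorted X → Unique X
sorted⇒unique = AP.map <⇒≢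

Sorted-++⇒< : ∀ {X Y} → Sorted (X ++ Y) → ∀ {a b} → a ∈ X → b ∈ Y → a < b
Sorted-++⇒< {x ∷ X} (x< ∷ _) (here refl) b∈Y = All.lookup (AllP.++⁻ʳ X x<) b∈Y
Sorted-++⇒< {x ∷ X} (_ ∷ s)  (there a∈X) b∈Y = Sorted-++⇒< s a∈X b∈Y

Sorted⇒take<drop : ∀ t {Z} → Sorted Z → ∀ {a b} → a ∈ take t Z → b ∈ drop t Z → a < b
Sorted⇒take<drop t {Z} s = Sorted-++⇒< (subst Sorted (sym (LP.take++drop≡id t Z)) s)

-- Levels

T-mono : ∀ {a b} → a ≤ b → T a ≤ T b
T-mono {zero}          _         = z≤n
T-mono {suc a} {suc b} (s≤s a≤b) = +-mono-≤ (T-mono a≤b) (s≤s a≤b)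

lowerLevels : ℕ → List ℕ → List ℕ
lowerLevels n Z = take (T n) Z

topLevel : ℕ → List ℕ → List ℕ
topLevel n Z = drop (T n) Z

length-lowerLevels : ∀ {n Z} → length Z ≡ T (suc n) → length (lowerLevels n Z) ≡ T n
length-lowerLevels {n} {Z} = length-take-+ (T n) (suc n) Z

length-topLevel : ∀ {n Z} → length Z ≡ T (suc n) → length (topLevel n Z) ≡ suc n
length-topLevel {n} {Z} = length-drop-+ (T n) (suc n) Z

level-⊆ : ∀ j (X : List ℕ) → level X j ⊆ X
level-⊆ j X = drop-⊆ (T j) X ∘ take-⊆ (suc j) (drop (T j) X)

level-++ : ∀ j (X Y : List ℕ) → T (suc j) ≤ length X → level (X ++ Y) j ≡ level X j
level-++ j X Y h =
  trans (cong (take (suc j)) (drop-++ (T j) X Y (≤-trans (m≤m+n (T j) (suc j)) h)))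
        (take-++ (suc j) (drop (T j) X) Y (≤-length-drop (T j) (suc j) X h))

level-++-top : ∀ k (X Y : List ℕ) → length X ≡ T k → length Y ≡ suc k → level (X ++ Y) k ≡ Y
level-++-top k X Y lX lY =
  trans (cong (take (suc k)) (subst (λ t → drop t (X ++ Y) ≡ Y) lX (drop-length-++ X Y)))
        (LP.take-all (suc k) Y (≤-reflexive lY))

level-lowerLevels : ∀ n i (Z : List ℕ) → length Z ≡ T (suc n) → i < n → level Z i ≡ level (lowerLevels n Z) i
level-lowerLevels n i Z lZ i<n =
  trans (cong (λ X → level X i) (sym (LP.take++drop≡id (T n) Z)))
        (level-++ i _ _ (subst (T (suc i) ≤_) (sym (length-lowerLevels lZ)) (T-mono i<n)))

level-inject₁ : ∀ {n} (Z : List ℕ) → length Z ≡ T (suc n) → (i : Fin n) →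
  level Z (toℕ (inject₁ i)) ≡ level (lowerLevels n Z) (toℕ i)
level-inject₁ {n} Z lZ i =
  trans (cong (level Z) (FP.toℕ-inject₁ i)) (level-lowerLevels n (toℕ i) Z lZ (FP.toℕ<n i))

level-top : ∀ n (Z : List ℕ) → length Z ≡ T (suc n) → level Z n ≡ topLevel n Z
level-top n Z lZ = LP.take-all (suc n) (drop (T n) Z) (≤-reflexive (length-topLevel lZ))

level-nonempty : ∀ {k} (X : List ℕ) → length X ≡ T k → (j : Fin k) → ∃ λ y → y ∈ level X (toℕ j)
level-nonempty {k} X lX j = nonempty (drop (T (toℕ j)) X)
  (≤-length-drop (T (toℕ j)) (suc (toℕ j)) X (subst (T (suc (toℕ j)) ≤_) (sym lX) (T-mono (FP.toℕ<n j))))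
  where
  nonempty : ∀ (D : List ℕ) → suc (toℕ j) ≤ length D → ∃ λ y → y ∈ take (suc (toℕ j)) D
  nonempty (y ∷ D) _ = y , here refl

Sorted-level-< : ∀ {W} → Sorted W → ∀ {i j a b} → i < j → a ∈ level W i → b ∈ level W j → a < b
Sorted-level-< {W} s {i} {j} i<j a∈ b∈ =
  Sorted⇒take<drop (T j) s (take-mono-⊆ (T-mono i<j) W (take-drop-⊆ (T i) (suc i) W a∈))
                           (take-⊆ (suc j) (drop (T j) W) b∈)

-- Combinations

combinations : ℕ → List A → List (List A)
combinations zero    L       = [ [] ]
combinations (suc k) []      = []
combinations (suc k) (x ∷ L) = map (x ∷_) (combinations k L) ++ combinations (suc k) L

length-combinations : ∀ k (L : List A) → length (combinations k L) ≡ length L C k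
length-combinations zero    L       = refl
length-combinations (suc k) []      = refl
length-combinations (suc k) (x ∷ L) = begin
  length (map (x ∷_) (combinations k L) ++ combinations (suc k) L)
    ≡⟨ LP.length-++ (map (x ∷_) (combinations k L)) ⟩
  length (map (x ∷_) (combinations k L)) + length (combinations (suc k) L)
    ≡⟨ cong₂ _+_ (trans (LP.length-map (x ∷_) (combinations k L)) (length-combinations k L))
                 (length-combinations (suc k) L) ⟩
  length L C k + length L C suc k
    ≡⟨ nCk+nC[k+1]≡[n+1]C[k+1] (length L) k ⟩
  suc (length L) C suc k ∎
  where open ≡-Reasoning

∈-combinations⁻ : ∀ k (L : List A) {s} → s ∈ combinations k L → length s ≡ k × s ⊆ L
∈-combinations⁻ zero    L       (here refl) = refl , λ ()
∈-combinations⁻ (suc k) (x ∷ L) s∈ with ∈-++⁻ (map (x ∷_) (combinations k L)) s∈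
... | inj₁ s∈ˡ with ∈-map⁻ (x ∷_) s∈ˡ
...   | t , t∈ , refl with ∈-combinations⁻ k L t∈
...     | lt , t⊆ = cong suc lt , λ { (here e) → here e ; (there y∈) → there (t⊆ y∈) }
∈-combinations⁻ (suc k) (x ∷ L) s∈ | inj₂ s∈ʳ with ∈-combinations⁻ (suc k) L s∈ʳ
... | ls , s⊆ = ls , there ∘ s⊆

∈-combinations⁺ : ∀ k (L s : List ℕ) → Sorted s → Sorted L → s ⊆ L → length s ≡ k → s ∈ combinations k L
∈-combinations⁺ zero    L       []      _          _          _   _  = here refl
∈-combinations⁺ (suc k) []      (a ∷ s) _          _          s⊆L _  with s⊆L (here refl)
... | ()
∈-combinations⁺ (suc k) (b ∷ L) (a ∷ s) (a< ∷ ss) (b< ∷ sL) s⊆L ls with a ≟ b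
... | yes refl =
  ∈-++⁺ˡ (∈-map⁺ (b ∷_) (∈-combinations⁺ k L s ss sL s⊆L' (suc-injective ls)))
  where
  s⊆L' : s ⊆ L
  s⊆L' {y} y∈ with s⊆L (there y∈)
  ... | here refl = ⊥-elim (<-irrefl refl (All.lookup a< y∈))
  ... | there y∈L = y∈L
... | no a≢b =
  ∈-++⁺ʳ (map (b ∷_) (combinations k L)) (∈-combinations⁺ (suc k) L (a ∷ s) (a< ∷ ss) sL as⊆L ls)
  where
  a∈L : a ∈ L
  a∈L with s⊆L (here refl)
  ... | here a≡b = ⊥-elim (a≢b a≡b)
  ... | there a∈L = a∈L
  as⊆L : a ∷ s ⊆ L
  as⊆L (here refl) = a∈L
  as⊆L {y} (there y∈) with s⊆L (there y∈)
  ... | here refl = ⊥-elim (<-asym (All.lookup a< y∈) (All.lookup b< a∈L))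
  ... | there y∈L = y∈L

combinations-sorted : ∀ k (L : List ℕ) {s} → Sorted L → s ∈ combinations k L → Sorted s
combinations-sorted zero    L       _          (here refl) = []
combinations-sorted (suc k) (x ∷ L) (x< ∷ sL) s∈ with ∈-++⁻ (map (x ∷_) (combinations k L)) s∈
... | inj₁ s∈ˡ with ∈-map⁻ (x ∷_) s∈ˡ
...   | t , t∈ , refl =
  All.tabulate (All.lookup x< ∘ proj₂ (∈-combinations⁻ k L t∈)) ∷ combinations-sorted k L sL t∈
combinations-sorted (suc k) (x ∷ L) (_ ∷ sL) s∈ | inj₂ s∈ʳ = combinations-sorted (suc k) L sL s∈ʳ

combinations-unique : ∀ k (L : List A) → Unique L → Unique (combinations k L)
combinations-unique zero    L       _           = [] ∷ []
combinations-unique (suc k) []      _           = []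
combinations-unique (suc k) (x ∷ L) (x∉L ∷ uL) =
  UP.++⁺ (UP.map⁺ LP.∷-injectiveʳ (combinations-unique k L uL)) (combinations-unique (suc k) L uL) disjoint
  where
  disjoint : ∀ {v} → v ∈ map (x ∷_) (combinations k L) × v ∈ combinations (suc k) L → ⊥
  disjoint (p , q) with ∈-map⁻ (x ∷_) p
  ... | _ , _ , refl = All.lookup x∉L (proj₂ (∈-combinations⁻ (suc k) L q) (here refl)) refl

-- Subtriangles

LevelEmbedding : ℕ → ℕ → List ℕ → List ℕ → Set
LevelEmbedding k n X Y =
  Σ (Fin k → Fin n) λ f → Injective _≡_ _≡_ f × (∀ j → level X (toℕ j) ⊆ level Y (toℕ (f j)))

embedding-lift : ∀ {k n W} (Z : List ℕ) → length Z ≡ T (suc n) →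
  LevelEmbedding k n W (lowerLevels n Z) → LevelEmbedding k (suc n) W Z
embedding-lift Z lZ (f , inj , f-levels) =
  inject₁ ∘ f , inj ∘ FP.inject₁-injective ,
  λ j {x} x∈ → subst (x ∈_) (sym (level-inject₁ Z lZ (f j))) (f-levels j x∈)

embedding-into-lowerLevels : ∀ {k n W} (Z : List ℕ) → length Z ≡ T (suc n) →
  (e : LevelEmbedding k (suc n) W Z) → (∀ j → n ≢ toℕ (proj₁ e j)) → LevelEmbedding k n W (lowerLevels n Z)
embedding-into-lowerLevels {k} {n} {W} Z lZ (f , inj , f-levels) avoids = f′ , inj′ , f′-levels
  where
  f′ : Fin k → Fin n
  f′ j = lower₁ (f j) (avoids j)
  inject₁-f′ : ∀ j → inject₁ (f′ j) ≡ f j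
  inject₁-f′ j = FP.inject₁-lower₁ (f j) (avoids j)
  inj′ : Injective _≡_ _≡_ f′
  inj′ {i} {j} e = inj (trans (sym (inject₁-f′ i)) (trans (cong inject₁ e) (inject₁-f′ j)))
  f′-levels : ∀ j → level W (toℕ j) ⊆ level (lowerLevels n Z) (toℕ (f′ j))
  f′-levels j {x} x∈ =
    subst (x ∈_) (trans (cong (λ i → level Z (toℕ i)) (sym (inject₁-f′ j))) (level-inject₁ Z lZ (f′ j)))
          (f-levels j x∈)

embedding-from-lowerLevels : ∀ {k m Z} (W : List ℕ) → length W ≡ T (suc k) →
  LevelEmbedding (suc k) m W Z → LevelEmbedding k m (lowerLevels k W) Z
embedding-from-lowerLevels W lW (f , inj , f-levels) =
  f ∘ inject₁ , FP.inject₁-injective ∘ inj ,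
  λ j {x} x∈ → f-levels (inject₁ j) (subst (x ∈_) (sym (level-inject₁ W lW j)) x∈)

extendTop : ∀ {k n} → (Fin k → Fin n) → Fin (suc k) → Fin (suc n)
extendTop {k} {n} f j with k ≟ toℕ j
... | yes _ = fromℕ n
... | no k≢j = inject₁ (f (lower₁ j k≢j))

extendTop-view : ∀ {k n} (f : Fin k → Fin n) j →
  (toℕ j ≡ k × extendTop f j ≡ fromℕ n) ⊎ Σ (Fin k) λ j′ → toℕ j′ ≡ toℕ j × extendTop f j ≡ inject₁ (f j′)
extendTop-view {k} {n} f j with k ≟ toℕ j
... | yes k≡j = inj₁ (sym k≡j , refl)
... | no k≢j = inj₂ (lower₁ j k≢j , FP.toℕ-lower₁ j k≢j , refl)

extendTop-injective : ∀ {k n} (f : Fin k → Fin n) → Injective _≡_ _≡_ f → Injective _≡_ _≡_ (extendTop f)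
extendTop-injective {k} {n} f inj {i} {j} e with extendTop-view f i | extendTop-view f j
... | inj₁ (i≡k , _)         | inj₁ (j≡k , _)         = FP.toℕ-injective (trans i≡k (sym j≡k))
... | inj₁ (_ , ei)          | inj₂ (j′ , _ , ej)     =
  ⊥-elim (FP.toℕ-inject₁-≢ (f j′) (trans (sym (FP.toℕ-fromℕ n)) (cong toℕ (trans (sym ei) (trans e ej)))))
... | inj₂ (i′ , _ , ei)     | inj₁ (_ , ej)          =
  ⊥-elim (FP.toℕ-inject₁-≢ (f i′) (trans (sym (FP.toℕ-fromℕ n)) (cong toℕ (trans (sym ej) (trans (sym e) ei)))))
... | inj₂ (i′ , i′≡i , ei) | inj₂ (j′ , j′≡j , ej) =
  FP.toℕ-injective (trans (sym i′≡i)
    (trans (cong toℕ (inj (FP.inject₁-injective (trans (sym ei) (trans e ej))))) j′≡j))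

embedding-extend : ∀ {k n} (Z W s : List ℕ) → length Z ≡ T (suc n) → length W ≡ T k → length s ≡ suc k →
  LevelEmbedding k n W (lowerLevels n Z) → s ⊆ topLevel n Z → LevelEmbedding (suc k) (suc n) (W ++ s) Z
embedding-extend {k} {n} Z W s lZ lW ls (f , inj , f-levels) s⊆ =
  extendTop f , extendTop-injective f inj , levels
  where
  levels : ∀ j → level (W ++ s) (toℕ j) ⊆ level Z (toℕ (extendTop f j))
  levels j {x} x∈ with extendTop-view f j
  ... | inj₁ (j≡k , top↦top) =
    subst (x ∈_) (sym (trans (cong (λ i → level Z (toℕ i)) top↦top)
                             (trans (cong (level Z) (FP.toℕ-fromℕ n)) (level-top n Z lZ))))
      (s⊆ (subst (x ∈_) (trans (cong (level (W ++ s)) j≡k) (level-++-top k W s lW ls)) x∈))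
  ... | inj₂ (j′ , j′≡j , j↦fj′) =
    subst (x ∈_) (sym (trans (cong (λ i → level Z (toℕ i)) j↦fj′) (level-inject₁ Z lZ (f j′))))
      (f-levels j′ (subst (x ∈_) (trans (cong (level (W ++ s)) (sym j′≡j))
         (level-++ (toℕ j′) W s (subst (T (suc (toℕ j′)) ≤_) (sym lW) (T-mono (FP.toℕ<n j′))))) x∈))

-- If a level j₀ < k of W went to the top level of Z, the top level of W would go strictly
-- below it although its elements are larger.
embedding-top↦top : ∀ {k n} (Z W : List ℕ) → Sorted Z → length Z ≡ T (suc n) → Sorted W →
  length W ≡ T (suc k) → ((f , _) : LevelEmbedding (suc k) (suc n) W Z) → ∀ j₀ → toℕ (f j₀) ≡ n → toℕ j₀ ≡ k
embedding-top↦top {k} {n} Z W sZ lZ sW lW (f , inj , f-levels) j₀ fj₀≡n with k ≟ toℕ j₀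
... | yes k≡j₀ = sym k≡j₀
... | no k≢j₀ with level-nonempty W lW j₀ | level-nonempty W lW (fromℕ k)
...   | y , y∈ | z , z∈ = ⊥-elim (<-asym z<y y<z)
  where
  j₀<k : toℕ j₀ < k
  j₀<k = ≤∧≢⇒< (≤-pred (FP.toℕ<n j₀)) (k≢j₀ ∘ sym)
  fk<n : toℕ (f (fromℕ k)) < n
  fk<n = ≤∧≢⇒< (≤-pred (FP.toℕ<n (f (fromℕ k))))
    (λ fk≡n → k≢j₀ (trans (sym (FP.toℕ-fromℕ k)) (cong toℕ (inj (FP.toℕ-injective (trans fk≡n (sym fj₀≡n)))))))
  z<y : z < y
  z<y = Sorted⇒take<drop (T n) sZ
    (level-⊆ _ (lowerLevels n Z) (subst (z ∈_) (level-lowerLevels n _ Z lZ fk<n) (f-levels (fromℕ k) z∈)))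
    (subst (y ∈_) (trans (cong (level Z) fj₀≡n) (level-top n Z lZ)) (f-levels j₀ y∈))
  y<z : y < z
  y<z = Sorted-level-< sW (subst (toℕ j₀ <_) (sym (FP.toℕ-fromℕ k)) j₀<k) y∈ z∈

-- △ₖ(Z) for Z ∈ △ₙ.  A member either lies in the first n − 1 levels of Z, or its top level
-- is a (k+1)-subset of the top level of Z; this is the recursion defining [n k].
subtriangles : ℕ → ℕ → List ℕ → List (List ℕ)
subtriangles zero    n       Z = [ [] ]
subtriangles (suc k) zero    Z = []
subtriangles (suc k) (suc n) Z =
  subtriangles (suc k) n (lowerLevels n Z) ++
  cartesianProductWith _++_ (subtriangles k n (lowerLevels n Z)) (combinations (suc k) (topLevel n Z))

length-subtriangles : ∀ k n (Z : List ℕ) → length Z ≡ T n → length (subtriangles k n Z) ≡ brk n k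
length-subtriangles zero    n       Z _  = refl
length-subtriangles (suc k) zero    Z _  = refl
length-subtriangles (suc k) (suc n) Z lZ = begin
  length (subtriangles (suc k) n Z↓ ++ cartesianProductWith _++_ (subtriangles k n Z↓) (combinations (suc k) Zᵗ))
    ≡⟨ LP.length-++ (subtriangles (suc k) n Z↓) ⟩
  length (subtriangles (suc k) n Z↓) + length (cartesianProductWith _++_ (subtriangles k n Z↓) (combinations (suc k) Zᵗ))
    ≡⟨ cong (length (subtriangles (suc k) n Z↓) +_) (length-cartesianProductWith _++_ (subtriangles k n Z↓) _) ⟩
  length (subtriangles (suc k) n Z↓) + length (subtriangles k n Z↓) * length (combinations (suc k) Zᵗ)
    ≡⟨ cong₂ _+_ (length-subtriangles (suc k) n Z↓ (length-lowerLevels lZ))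
        (cong₂ _*_ (length-subtriangles k n Z↓ (length-lowerLevels lZ))
                   (trans (length-combinations (suc k) Zᵗ) (cong (_C suc k) (length-topLevel lZ)))) ⟩
  brk n (suc k) + brk n k * (suc n C suc k)
    ≡⟨ cong (brk n (suc k) +_) (*-comm (brk n k) _) ⟩
  brk (suc n) (suc k) ∎
  where
  open ≡-Reasoning
  Z↓ Zᵗ : List ℕ
  Z↓ = lowerLevels n Z
  Zᵗ = topLevel n Z

∈-subtriangles⁻ : ∀ k n (Z W : List ℕ) → Sorted Z → length Z ≡ T n → W ∈ subtriangles k n Z →
  Sorted W × length W ≡ T k × Leq k n W Z
∈-subtriangles⁻ zero    n       Z .[] _  _  (here refl) = [] , refl , (λ ()) , (λ ()) , (λ { {()} }) , λ ()
∈-subtriangles⁻ (suc k) (suc n) Z W   sZ lZ W∈ with ∈-++⁻ (subtriangles (suc k) n (lowerLevels n Z)) W∈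
... | inj₁ W∈↓ with ∈-subtriangles⁻ (suc k) n (lowerLevels n Z) W (APP.take⁺ (T n) sZ) (length-lowerLevels lZ) W∈↓
...   | sW , lW , W⊆ , e = sW , lW , take-⊆ (T n) Z ∘ W⊆ , embedding-lift Z lZ e
∈-subtriangles⁻ (suc k) (suc n) Z W   sZ lZ W∈ | inj₂ W∈×
  with ∈-cartesianProductWith⁻ _++_ (subtriangles k n (lowerLevels n Z)) (combinations (suc k) (topLevel n Z)) W∈×
... | W′ , s , W′∈ , s∈ , refl
  with ∈-subtriangles⁻ k n (lowerLevels n Z) W′ (APP.take⁺ (T n) sZ) (length-lowerLevels lZ) W′∈
     | ∈-combinations⁻ (suc k) (topLevel n Z) s∈
... | sW′ , lW′ , W′⊆ , e | ls , s⊆ =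
  sorted , trans (LP.length-++ W′) (cong₂ _+_ lW′ ls) , W′s⊆Z , embedding-extend Z W′ s lZ lW′ ls e s⊆
  where
  sorted : Sorted (W′ ++ s)
  sorted = APP.++⁺ sW′ (combinations-sorted (suc k) (topLevel n Z) (APP.drop⁺ (T n) sZ) s∈)
    (All.tabulate λ a∈ → All.tabulate λ b∈ → Sorted⇒take<drop (T n) sZ (W′⊆ a∈) (s⊆ b∈))
  W′s⊆Z : W′ ++ s ⊆ Z
  W′s⊆Z x∈ with ∈-++⁻ W′ x∈
  ... | inj₁ x∈W′ = take-⊆ (T n) Z (W′⊆ x∈W′)
  ... | inj₂ x∈s  = drop-⊆ (T n) Z (s⊆ x∈s)

∈-subtriangles⁺ : ∀ k n (Z W : List ℕ) → Sorted Z → length Z ≡ T n → Sorted W → length W ≡ T k →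
  LevelEmbedding k n W Z → W ∈ subtriangles k n Z
∈-subtriangles⁺ zero    n       Z []  _ _ _ _ _       = here refl
∈-subtriangles⁺ (suc k) zero    Z W   _ _ _ _ (f , _) with f F.zero
... | ()
∈-subtriangles⁺ (suc k) (suc n) Z W sZ lZ sW lW e@(f , inj , f-levels) with FP.any? (λ j → toℕ (f j) ≟ n)
... | no none =
  ∈-++⁺ˡ (∈-subtriangles⁺ (suc k) n (lowerLevels n Z) W (APP.take⁺ (T n) sZ) (length-lowerLevels lZ) sW lW
           (embedding-into-lowerLevels Z lZ e λ j n≡fj → none (j , sym n≡fj)))
... | yes (j₀ , fj₀≡n) =
  subst (_∈ subtriangles (suc k) (suc n) Z) (LP.take++drop≡id (T k) W)
    (∈-++⁺ʳ (subtriangles (suc k) n (lowerLevels n Z)) (∈-cartesianProductWith⁺ _++_ W↓∈ Wᵗ∈))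
  where
  j₀≡k : toℕ j₀ ≡ k
  j₀≡k = embedding-top↦top Z W sZ lZ sW lW e j₀ fj₀≡n
  avoids : ∀ j → n ≢ toℕ (f (inject₁ j))
  avoids j n≡ = FP.toℕ-inject₁-≢ j
    (trans (sym j₀≡k) (cong toℕ (sym (inj (FP.toℕ-injective (trans (sym n≡) (sym fj₀≡n)))))))
  W↓∈ : lowerLevels k W ∈ subtriangles k n (lowerLevels n Z)
  W↓∈ = ∈-subtriangles⁺ k n (lowerLevels n Z) (lowerLevels k W) (APP.take⁺ (T n) sZ) (length-lowerLevels lZ)
          (APP.take⁺ (T k) sW) (length-lowerLevels lW)
          (embedding-into-lowerLevels Z lZ (embedding-from-lowerLevels W lW e) avoids)
  Wᵗ⊆Zᵗ : topLevel k W ⊆ topLevel n Z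
  Wᵗ⊆Zᵗ {x} x∈ = subst (x ∈_) (trans (cong (level Z) fj₀≡n) (level-top n Z lZ))
    (f-levels j₀ (subst (x ∈_) (trans (sym (level-top k W lW)) (cong (level W) (sym j₀≡k))) x∈))
  Wᵗ∈ : topLevel k W ∈ combinations (suc k) (topLevel n Z)
  Wᵗ∈ = ∈-combinations⁺ (suc k) (topLevel n Z) (topLevel k W) (APP.drop⁺ (T k) sW) (APP.drop⁺ (T n) sZ)
          Wᵗ⊆Zᵗ (length-topLevel lW)

subtriangles-unique : ∀ k n (Z : List ℕ) → Sorted Z → length Z ≡ T n → Unique (subtriangles k n Z)
subtriangles-unique zero    n       Z _  _  = [] ∷ []
subtriangles-unique (suc k) zero    Z _  _  = []
subtriangles-unique (suc k) (suc n) Z sZ lZ =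
  UP.++⁺ (subtriangles-unique (suc k) n Z↓ sZ↓ lZ↓)
    (cartesianProductWith-++-unique (T k) (subtriangles k n Z↓) (combinations (suc k) (topLevel n Z))
      (All.tabulate (λ W∈ → proj₁ (proj₂ (∈-subtriangles⁻ k n Z↓ _ sZ↓ lZ↓ W∈))))
      (subtriangles-unique k n Z↓ sZ↓ lZ↓)
      (combinations-unique (suc k) (topLevel n Z) (sorted⇒unique (APP.drop⁺ (T n) sZ))))
    disjoint
  where
  Z↓ : List ℕ
  Z↓ = lowerLevels n Z
  sZ↓ : Sorted Z↓
  sZ↓ = APP.take⁺ (T n) sZ
  lZ↓ : length Z↓ ≡ T n
  lZ↓ = length-lowerLevels lZ
  -- a member of the second part has an element in the top level of Z, one of the first part has not
  disjoint : ∀ {V} → V ∈ subtriangles (suc k) n Z↓ ×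
    V ∈ cartesianProductWith _++_ (subtriangles k n Z↓) (combinations (suc k) (topLevel n Z)) → ⊥
  disjoint (V∈ , V∈×) with ∈-cartesianProductWith⁻ _++_ (subtriangles k n Z↓) (combinations (suc k) (topLevel n Z)) V∈×
  ... | W′ , s , _ , s∈ , refl with ∈-combinations⁻ (suc k) (topLevel n Z) s∈
                                   | proj₁ (proj₂ (proj₂ (∈-subtriangles⁻ (suc k) n Z↓ (W′ ++ s) sZ↓ lZ↓ V∈)))
  ... | ls , s⊆ | V⊆Z↓ = top∉Z↓ s ls s⊆ λ y∈s → V⊆Z↓ (∈-++⁺ʳ W′ y∈s)
    where
    top∉Z↓ : ∀ t → length t ≡ suc k → t ⊆ topLevel n Z → t ⊆ Z↓ → ⊥
    top∉Z↓ (y ∷ t) _ t⊆ᵗ t⊆↓ = <-irrefl refl (Sorted⇒take<drop (T n) sZ (t⊆↓ (here refl)) (t⊆ᵗ (here refl)))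

-- Colourings avoiding monochromatic sets

+-split-both : ∀ w R a b → R ≡ a + b → 2 * w + R ≡ (w + a) + (w + b)
+-split-both w R a b refl = solve 3 (λ w a b → con 2 :* w :+ (a :+ b) := (w :+ a) :+ (w :+ b)) refl w a b

+-split-left : ∀ w R a b → R ≡ a + b → w + R ≡ (w + a) + b
+-split-left w R a b refl = sym (+-assoc w a b)

+-split-right : ∀ w R a b → R ≡ a + b → w + R ≡ a + (w + b)
+-split-right w R a b refl = solve 3 (λ w a b → w :+ (a :+ b) := a :+ (w :+ b)) refl w a b

+<2*⇒<⊎< : ∀ a b n → a + b < 2 * n → a < n ⊎ b < n
+<2*⇒<⊎< a b n a+b<2n with a <? n
... | yes a<n = inj₁ a<n
... | no a≮n  = inj₂ (+-cancelˡ-< a b n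
  (<-≤-trans (subst (a + b <_) (cong (n +_) (+-identityʳ n)) a+b<2n) (+-monoˡ-≤ n (≮⇒≥ a≮n))))

module Colouring {A : Set} (_≟ᴬ_ : DecidableEquality A) where
  open import Data.List.Membership.DecPropositional _≟ᴬ_ using (_∈?_)

  free : List A → List A → ℕ
  free []      E = 0
  free (x ∷ S) E with x ∈? E
  ... | yes _ = free S E
  ... | no _  = suc (free S E)

  shared : List A → List A → List A
  shared []      E = []
  shared (x ∷ S) E with x ∈? E
  ... | yes _ = x ∷ shared S E
  ... | no _  = shared S E

  free+length-shared : ∀ S E → free S E + length (shared S E) ≡ length S
  free+length-shared []      E = refl
  free+length-shared (x ∷ S) E with x ∈? E
  ... | yes _ = trans (+-suc (free S E) _) (cong suc (free+length-shared S E))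
  ... | no _  = cong suc (free+length-shared S E)

  ∈-shared : ∀ S E {y} → y ∈ S → y ∈ E → y ∈ shared S E
  ∈-shared (x ∷ S) E (here refl) y∈E with x ∈? E
  ... | yes _   = here refl
  ... | no x∉E = ⊥-elim (x∉E y∈E)
  ∈-shared (x ∷ S) E (there y∈S) y∈E with x ∈? E
  ... | yes _ = there (∈-shared S E y∈S y∈E)
  ... | no _  = ∈-shared S E y∈S y∈E

  free+length≤ : ∀ S E → Unique E → E ⊆ S → free S E + length E ≤ length S
  free+length≤ S E uE E⊆S = subst (free S E + length E ≤_) (free+length-shared S E)
    (+-monoʳ-≤ (free S E) (Unique-⊆⇒length≤ E (shared S E) uE (λ y∈ → ∈-shared S E (E⊆S y∈) y∈)))

  -- (E , b) stands for the event that all of E is coloured b.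
  Event : Set
  Event = List A × Bool

  -- 2^|S| times the probability of (E , b) under a uniformly random colouring of S.
  weight : List A → Event → ℕ
  weight S (E , _) = 2 ^ free S E

  weight*2^length≤ : ∀ S E b → Unique E → E ⊆ S → weight S (E , b) * 2 ^ length E ≤ 2 ^ length S
  weight*2^length≤ S E b uE E⊆S =
    subst (_≤ 2 ^ length S) (^-distribˡ-+-* 2 (free S E) (length E)) (^-monoʳ-≤ 2 (free+length≤ S E uE E⊆S))

  Avoids : List A → (A → Bool) → Event → Set
  Avoids S c (E , b) = ∃ λ y → y ∈ E × y ∈ S × c y ≢ b

  -- the events still possible once x is coloured v
  condition : A → Bool → List Event → List Event
  condition x v []             = []
  condition x v ((E , b) ∷ es) with x ∈? E | b Bool.≟ v
  ... | no _  | _     = (E , b) ∷ condition x v es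
  ... | yes _ | yes _ = (E , b) ∷ condition x v es
  ... | yes _ | no _  = condition x v es

  totalWeight : List A → List Event → ℕ
  totalWeight S es = sum (map (weight S) es)

  totalWeight-++ : ∀ S es fs → totalWeight S (es ++ fs) ≡ totalWeight S es + totalWeight S fs
  totalWeight-++ S es fs = trans (cong sum (LP.map-++ (weight S) es fs)) (sum-++ (map (weight S) es) _)

  weight-condition : ∀ x S es →
    totalWeight (x ∷ S) es ≡ totalWeight S (condition x true es) + totalWeight S (condition x false es)
  weight-condition x S []             = refl
  weight-condition x S ((E , b) ∷ es) with x ∈? E | weight-condition x S es
  ... | no _  | ih = +-split-both (2 ^ free S E) _ (totalWeight S (condition x true es)) _ ih
  ... | yes _ | ih with b
  ...   | true  = +-split-left  (2 ^ free S E) _ (totalWeight S (condition x true es)) _ ih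
  ...   | false = +-split-right (2 ^ free S E) _ (totalWeight S (condition x true es)) _ ih

  recolour : A → Bool → (A → Bool) → A → Bool
  recolour x v c y with y ≟ᴬ x
  ... | yes _ = v
  ... | no _  = c y

  recolour-≡ : ∀ x v c → recolour x v c x ≡ v
  recolour-≡ x v c with x ≟ᴬ x
  ... | yes _  = refl
  ... | no x≢x = ⊥-elim (x≢x refl)

  recolour-≢ : ∀ x v c {y} → y ≢ x → recolour x v c y ≡ c y
  recolour-≢ x v c {y} y≢x with y ≟ᴬ x
  ... | yes y≡x = ⊥-elim (y≢x y≡x)
  ... | no _    = refl

  Avoids-recolour : ∀ x S v c → x ∉ S → ∀ e → Avoids S c e → Avoids (x ∷ S) (recolour x v c) e
  Avoids-recolour x S v c x∉S (E , b) (y , y∈E , y∈S , cy≢b) =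
    y , y∈E , there y∈S , λ cy≡b → cy≢b (trans (sym (recolour-≢ x v c λ { refl → x∉S y∈S })) cy≡b)

  Avoids-condition : ∀ x S v c → x ∉ S → ∀ es →
    All (Avoids S c) (condition x v es) → All (Avoids (x ∷ S) (recolour x v c)) es
  Avoids-condition x S v c x∉S []             _        = []
  Avoids-condition x S v c x∉S ((E , b) ∷ es) avoided with x ∈? E | b Bool.≟ v
  ... | no _    | _      = Avoids-recolour x S v c x∉S (E , b) (All.head avoided)
                         ∷ Avoids-condition x S v c x∉S es (All.tail avoided)
  ... | yes _   | yes _  = Avoids-recolour x S v c x∉S (E , b) (All.head avoided)
                         ∷ Avoids-condition x S v c x∉S es (All.tail avoided)
  ... | yes x∈E | no b≢v = (x , x∈E , here refl , λ x↦b → b≢v (trans (sym x↦b) (recolour-≡ x v c)))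
                         ∷ Avoids-condition x S v c x∉S es avoided

  -- Colour x so that the total weight of the remaining events stays below 2^|S|.
  avoiding-colouring : ∀ S → Unique S → ∀ es → totalWeight S es < 2 ^ length S →
    Σ (A → Bool) λ c → All (Avoids S c) es
  avoiding-colouring []      _           []      _           = (λ _ → true) , []
  avoiding-colouring []      _           (_ ∷ _) (s≤s ())
  avoiding-colouring (x ∷ S) (x∉S ∷ uS) es      total<
    with +<2*⇒<⊎< _ _ (2 ^ length S) (subst (_< 2 ^ suc (length S)) (weight-condition x S es) total<)
  ... | inj₁ true< with avoiding-colouring S uS (condition x true es) true<
  ...   | c , avoided = recolour x true c , Avoids-condition x S true c (AllP.All¬⇒¬Any x∉S) es avoided
  avoiding-colouring (x ∷ S) (x∉S ∷ uS) es total< | inj₂ false<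
    with avoiding-colouring S uS (condition x false es) false<
  ...   | c , avoided = recolour x false c , Avoids-condition x S false c (AllP.All¬⇒¬Any x∉S) es avoided

brk-suc-≤ : ∀ n k → brk n k ≤ brk (suc n) k
brk-suc-≤ n zero    = ≤-refl
brk-suc-≤ n (suc k) = m≤m+n _ _

brk-monoˡ-≤′ : ∀ k {m′ m} → m′ ≤′ m → brk m′ k ≤ brk m k
brk-monoˡ-≤′ k ≤′-refl        = ≤-refl
brk-monoˡ-≤′ k (≤′-step m′≤m) = ≤-trans (brk-monoˡ-≤′ k m′≤m) (brk-suc-≤ _ k)

sum*≤length* : ∀ (xs : List ℕ) a M → All (λ x → x * a ≤ M) xs → sum xs * a ≤ length xs * M
sum*≤length* []       a M _            = z≤n
sum*≤length* (x ∷ xs) a M (xa≤M ∷ al) =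
  subst (_≤ M + length xs * M) (sym (*-distribʳ-+ a x (sum xs))) (+-mono-≤ xa≤M (sum*≤length* xs a M al))

-- Cross-multiplied form of: P/X ≤ A/a, Q/X ≤ B/b and A/a + B/b < 1 imply P/X + Q/X < 1.
fractions<1 : ∀ P Q A B a b X → 0 < X → P * a ≤ A * X → Q * b ≤ B * X → A * b + B * a < a * b → P + Q < X
fractions<1 P Q A B a b (suc X) _ Pa≤AX Qb≤BX Ab+Ba<ab = *-cancelʳ-< _ _ _ (begin-strict
  (P + Q) * (a * b)
    ≡⟨ solve 4 (λ P Q a b → (P :+ Q) :* (a :* b) := (P :* a) :* b :+ (Q :* b) :* a) refl P Q a b ⟩
  (P * a) * b + (Q * b) * a
    ≤⟨ +-mono-≤ (*-monoˡ-≤ b Pa≤AX) (*-monoˡ-≤ a Qb≤BX) ⟩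
  (A * suc X) * b + (B * suc X) * a
    ≡⟨ solve 5 (λ A B X a b → (A :* X) :* b :+ (B :* X) :* a := X :* (A :* b :+ B :* a)) refl A B (suc X) a b ⟩
  suc X * (A * b + B * a)
    <⟨ *-monoʳ-< (suc X) Ab+Ba<ab ⟩
  suc X * (a * b) ∎)
  where open ≤-Reasoning

-- Draws

board : ℕ → List ℕ
board m = upTo (T m)

board-sorted : ∀ m → Sorted (board m)
board-sorted m = linked⇒sorted (LinkedP.applyUpTo⁺₂ id (T m) n<1+n)

length-board : ∀ m → length (board m) ≡ T m
length-board m = LP.length-upTo (T m)

open Colouring (LP.≡-dec _≟_)

winEvents : (k r m : ℕ) → Bool → List Event
winEvents k r m b = map (λ Z → subtriangles k r Z , b) (subtriangles r m (board m))

Win : (r k m : ℕ) → List ℕ → (List ℕ → Bool) → Bool → Set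
Win r k m B c b = ∃ λ Z → Tri r Z × Leq r m Z B × (∀ W → Tri k W → Leq k r W Z → c W ≡ b)

Avoids⇒¬Win : ∀ {S c} r k m b → All (Avoids S c) (winEvents k r m b) → ¬ Win r k m (board m) c b
Avoids⇒¬Win r k m b avoided (Z , (lkZ , lZ) , (_ , e) , mono)
  with All.lookup avoided (∈-map⁺ (λ Z → subtriangles k r Z , b)
         (∈-subtriangles⁺ r m (board m) Z (board-sorted m) (length-board m) (linked⇒sorted lkZ) lZ e))
... | W , W∈ , _ , cW≢b with ∈-subtriangles⁻ k r Z W (linked⇒sorted lkZ) lZ W∈
... | sW , lW , W≤Z = cW≢b (mono W (sorted⇒linked sW , lW) W≤Z)

totalWeight-winEvents : ∀ S k r m b → (∀ {Z} → Z ∈ subtriangles r m (board m) → subtriangles k r Z ⊆ S) →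
  totalWeight S (winEvents k r m b) * 2 ^ brk r k ≤ brk m r * 2 ^ length S
totalWeight-winEvents S k r m b ⊆S =
  subst (λ l → totalWeight S (winEvents k r m b) * 2 ^ brk r k ≤ l * 2 ^ length S) count
    (sum*≤length* _ (2 ^ brk r k) (2 ^ length S) (AllP.map⁺ (AllP.map⁺ (All.tabulate bound))))
  where
  bound : ∀ {Z} → Z ∈ subtriangles r m (board m) → weight S (subtriangles k r Z , b) * 2 ^ brk r k ≤ 2 ^ length S
  bound {Z} Z∈ with ∈-subtriangles⁻ r m (board m) Z (board-sorted m) (length-board m) Z∈
  ... | sZ , lZ , _ =
    subst (λ l → weight S (subtriangles k r Z , b) * 2 ^ l ≤ 2 ^ length S) (length-subtriangles k r Z lZ)
      (weight*2^length≤ S _ b (subtriangles-unique k r Z sZ lZ) (⊆S Z∈))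
  count : length (map (weight S) (winEvents k r m b)) ≡ brk m r
  count = trans (LP.length-map (weight S) (winEvents k r m b))
         (trans (LP.length-map _ (subtriangles r m (board m))) (length-subtriangles r m (board m) (length-board m)))

hasDraw : ∀ p q k m m′ → brk m p * 2 ^ brk q k + brk m q * 2 ^ brk p k < 2 ^ (brk p k + brk q k) →
  m′ ≤ m → HasDraw p q k m′
hasDraw p q k m m′ hyp m′≤m =
  board m′ , (sorted⇒linked (board-sorted m′) , length-board m′) , c ,
  Avoids⇒¬Win p k m′ true (AllP.++⁻ˡ (winEvents k p m′ true) avoided) ,
  Avoids⇒¬Win q k m′ false (AllP.++⁻ʳ (winEvents k p m′ true) avoided)
  where
  events : List Event
  events = winEvents k p m′ true ++ winEvents k q m′ false
  S : List (List ℕ)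
  S = deduplicate (LP.≡-dec _≟_) (concat (map proj₁ events))
  ⊆S : ∀ {E b} → (E , b) ∈ events → E ⊆ S
  ⊆S e∈ y∈ = ∈-deduplicate⁺ (LP.≡-dec _≟_) (∈-concat⁺′ y∈ (∈-map⁺ proj₁ e∈))
  weightᵖ : totalWeight S (winEvents k p m′ true) * 2 ^ brk p k ≤ brk m p * 2 ^ length S
  weightᵖ = ≤-trans (totalWeight-winEvents S k p m′ true (⊆S ∘ ∈-++⁺ˡ ∘ ∈-map⁺ _))
                    (*-monoˡ-≤ (2 ^ length S) (brk-monoˡ-≤′ p (≤⇒≤′ m′≤m)))
  weightᵠ : totalWeight S (winEvents k q m′ false) * 2 ^ brk q k ≤ brk m q * 2 ^ length S
  weightᵠ = ≤-trans (totalWeight-winEvents S k q m′ false (⊆S ∘ ∈-++⁺ʳ (winEvents k p m′ true) ∘ ∈-map⁺ _))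
                    (*-monoˡ-≤ (2 ^ length S) (brk-monoˡ-≤′ q (≤⇒≤′ m′≤m)))
  total< : totalWeight S events < 2 ^ length S
  total< = subst (_< 2 ^ length S) (sym (totalWeight-++ S (winEvents k p m′ true) _))
    (fractions<1 (totalWeight S (winEvents k p m′ true)) (totalWeight S (winEvents k q m′ false))
                 (brk m p) (brk m q) (2 ^ brk p k) (2 ^ brk q k) (2 ^ length S) (m^n>0 2 (length S))
                 weightᵖ weightᵠ (subst (brk m p * 2 ^ brk q k + brk m q * 2 ^ brk p k <_)
                                        (^-distribˡ-+-* 2 (brk p k) (brk q k)) hyp))
  colouring : Σ (List ℕ → Bool) λ c → All (Avoids S c) events
  colouring = avoiding-colouring S (deduplicate-! (LP.≡-dec _≟_) _) events total<
  c : List ℕ → Bool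
  c = proj₁ colouring
  avoided : All (Avoids S c) events
  avoided = proj₂ colouring

theorem9 : (p q k m : ℕ) → k ≤ p → p ≤ q → q ≤ m →
    brk m p * 2 ^ brk q k + brk m q * 2 ^ brk p k < 2 ^ (brk p k + brk q k) →
    R1Greater p q k m
theorem9 p q k m _ _ _ hyp m′ _ noDraw with m <? m′
... | yes m<m′ = m<m′
... | no m≮m′  = ⊥-elim (noDraw (hasDraw p q k m m′ hyp (≮⇒≥ m≮m′)))
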